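{- Fix positive integers $n,m$. There exists a real number $B(n,m)$, depending only on $n$ and $m$, such that for every product $P$ of $m$ Eisenstein series (of arbitrary weights), \[ |a_P(n)|\le B(n,m). \]
   Context: For a modular form $f$ for $\mathrm{SL}_2(\mathbb{Z})$, $a_f(n)$ denotes its $n$-th Fourier coefficient: $f(z)=\sum_{n\ge0}a_f(n)q^n$, $q=e^{2\pi i z}$. For even $k\ge4$, the Eisenstein series is $E_k(z)=1+C_k\sum_{n\ge1}\sigma_{k-1}(n)q^n$ with $C_k=\frac{(2\pi i)^k}{(k-1)!\zeta(k)}=-2k/B_k$, $B_k$ the $k$-th Bernoulli number. -}

module Defs where

open import Data.Nat as ℕ using (ℕ; zero; suc; _∸_; _^_)
open import Data.Nat.Divisibility using (_∣_; _∣?_)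
open import Data.Nat.Combinatorics using (_C_)
open import Data.Integer using (+_)
open import Data.Rational using (ℚ; 0ℚ; 1ℚ; _+_; _*_; -_; _/_; 1/_; ≢-nonZero)
open import Data.Rational.Properties using (_≟_)
open import Data.List using (List; []; _∷_; _∷ʳ_)
open import Data.Fin as Fin using (Fin)
open import Relation.Nullary using (yes; no)

ℕtoℚ : ℕ → ℚ
ℕtoℚ n = (+ n) / 1

sumTo : ℕ → (ℕ → ℚ) → ℚ
sumTo zero    f = 0ℚ
sumTo (suc n) f = sumTo n f + f n

-- total inverse on ℚ (inv 0 = 0); only applied to nonzero values in the statement
inv : ℚ → ℚ
inv p with p ≟ 0ℚ
... | yes _  = 0ℚ
... | no p≢0 = 1/_ p {{≢-nonZero p≢0}}

nth : List ℚ → ℕ → ℚ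
nth []       _       = 0ℚ
nth (x ∷ xs) zero    = x
nth (x ∷ xs) (suc j) = nth xs j

-- the list [B_0, …, B_n] of Bernoulli numbers, via the recursion
-- B_0 = 1,  B_N = -(1/(N+1)) Σ_{j=0}^{N-1} binom(N+1, j) B_j
-- (convention B_1 = -1/2; irrelevant here, only even indices ≥ 4 are used)
bernoulliList : ℕ → List ℚ
bernoulliList zero    = 1ℚ ∷ []
bernoulliList (suc n) = prev ∷ʳ next
  where
  prev = bernoulliList n
  next = - (inv (ℕtoℚ (suc (suc n)))
              * sumTo (suc n) (λ j → ℕtoℚ (suc (suc n) C j) * nth prev j))

bernoulli : ℕ → ℚ
bernoulli k = nth (bernoulliList k) k

σ : ℕ → ℕ → ℚ
σ r n = sumTo n (λ i → term (suc i))
  where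
  term : ℕ → ℚ
  term d with d ∣? n
  ... | yes _ = ℕtoℚ (d ^ r)
  ... | no  _ = 0ℚ

eisensteinConst : ℕ → ℚ
eisensteinConst k = - (ℕtoℚ (2 ℕ.* k) * inv (bernoulli k))

eisensteinCoeff : ℕ → ℕ → ℚ
eisensteinCoeff k zero    = 1ℚ
eisensteinCoeff k (suc n) = eisensteinConst k * σ (k ∸ 1) (suc n)

_⊛_ : (ℕ → ℚ) → (ℕ → ℚ) → ℕ → ℚ
(f ⊛ g) n = sumTo (suc n) (λ j → f j * g (n ∸ j))

oneSeries : ℕ → ℚ
oneSeries zero    = 1ℚ
oneSeries (suc _) = 0ℚ

eisensteinProductCoeff : (m : ℕ) → (Fin m → ℕ) → ℕ → ℚ
eisensteinProductCoeff zero    ks = oneSeries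
eisensteinProductCoeff (suc m) ks =
  eisensteinCoeff (ks Fin.zero) ⊛ eisensteinProductCoeff m (λ i → ks (Fin.suc i))

record IsEisensteinWeight (k : ℕ) : Set where
  field
    even  : 2 ∣ k
    four≤ : 4 ℕ.≤ k

-- Since σ_{k−1}(m) ≤ m^k, the coefficients of E_k are bounded uniformly in k as soon as
-- |B_k| outgrows every exponential. That growth is read off the Riccati equation
-- x B′ = B − x B − B² of B(x) = x/(eˣ − 1) = Σ B_j xʲ/j!: the odd coefficients beyond B_1
-- vanish, and W_k = 60^k (−1)^(k+1) B_{2k}/(2k)! satisfies (2k+1) W_k = Σ_{0<i<k} W_i W_{k−i}
-- with W_1 = 5, so W_k ≥ 5 and |B_{2k}| ≥ (2k)!/60^k. Then |a_{E_{2k}}(m)| ≤ 60^k·4k·m^{2k}/(2k)!,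
-- which is bounded in k, and the bound propagates through the Cauchy product of m factors.

module Submission where

open import Defs
open import Data.Nat as ℕ using (ℕ; zero; suc; _∸_; _^_; _!; _>_; s≤s; z≤n)
import Data.Nat.Properties as ℕ
open import Data.Nat.Induction using (<-rec)
open import Data.Nat.Combinatorics using (_C_; nCk≡nC[n∸k]; nC1≡n; k![n∸k]!∣n!)
open import Data.Nat.Combinatorics.Specification using (nCk≡n!/k![n-k]!)
open import Data.Nat.DivMod using (m/n*n≡m)
open import Data.Nat.Divisibility using (_∣?_; divides)
import Data.Nat.Coprimality as Coprime
open import Data.Nat.Tactic.RingSolver using (solve-∀)
import Data.Integer as ℤ
import Data.Integer.Properties as ℤ
open import Data.Rational using (ℚ; ½; NonNegative; 0ℚ; 1ℚ; _+_; _*_; -_; _-_; ∣_∣; _≤_; _<_; toℚᵘ; positive; nonNegative; ≢-nonZero)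
open import Data.Rational.Properties hiding (_≟_)
import Data.Rational.Properties as ℚ
import Data.Rational.Unnormalised as ℚᵘ
import Data.Rational.Unnormalised.Properties as ℚᵘ
open import Data.Rational.Solver using (module +-*-Solver)
open +-*-Solver using (solve; _:+_; _:*_; :-_; _:=_; con)
open import Data.List using (List; []; _∷_; _∷ʳ_; length)
import Data.List.Properties as List
open import Data.Fin as Fin using (Fin)
open import Data.Product using (∃-syntax; _,_)
open import Data.Sum using (inj₁; inj₂)
open import Data.Empty using (⊥-elim)
open import Relation.Nullary using (yes; no)
open import Relation.Binary.PropositionalEquality
open import Function using (_∘_)

toℚᵘ-ℕtoℚ : ∀ n → toℚᵘ (ℕtoℚ n) ≡ ℚᵘ.mkℚᵘ (ℤ.+ n) 0
toℚᵘ-ℕtoℚ n = cong toℚᵘ (normalize-coprime (Coprime.sym (Coprime.1-coprimeTo n)))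

ℕtoℚ-+ : ∀ a b → ℕtoℚ (a ℕ.+ b) ≡ ℕtoℚ a + ℕtoℚ b
ℕtoℚ-+ a b = toℚᵘ-injective (begin
  toℚᵘ (ℕtoℚ (a ℕ.+ b))                    ≡⟨ toℚᵘ-ℕtoℚ (a ℕ.+ b) ⟩
  ℚᵘ.mkℚᵘ (ℤ.+ (a ℕ.+ b)) 0                 ≈⟨ ℚᵘ.*≡* eq ⟩
  ℚᵘ.mkℚᵘ (ℤ.+ a) 0 ℚᵘ.+ ℚᵘ.mkℚᵘ (ℤ.+ b) 0  ≡⟨ cong₂ ℚᵘ._+_ (toℚᵘ-ℕtoℚ a) (toℚᵘ-ℕtoℚ b) ⟨
  toℚᵘ (ℕtoℚ a) ℚᵘ.+ toℚᵘ (ℕtoℚ b)          ≈⟨ toℚᵘ-homo-+ (ℕtoℚ a) (ℕtoℚ b) ⟨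
  toℚᵘ (ℕtoℚ a + ℕtoℚ b)                    ∎)
  where
  open import Relation.Binary.Reasoning.Setoid ℚᵘ.≃-setoid
  eq : ℤ.+ (a ℕ.+ b) ℤ.* ℤ.1ℤ ≡ (ℤ.+ a ℤ.* ℤ.1ℤ ℤ.+ ℤ.+ b ℤ.* ℤ.1ℤ) ℤ.* ℤ.1ℤ
  eq rewrite ℤ.*-identityʳ (ℤ.+ a) | ℤ.*-identityʳ (ℤ.+ b) = cong (ℤ._* ℤ.1ℤ) (ℤ.pos-+ a b)

ℕtoℚ-* : ∀ a b → ℕtoℚ (a ℕ.* b) ≡ ℕtoℚ a * ℕtoℚ b
ℕtoℚ-* a b = toℚᵘ-injective (begin
  toℚᵘ (ℕtoℚ (a ℕ.* b))                    ≡⟨ toℚᵘ-ℕtoℚ (a ℕ.* b) ⟩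
  ℚᵘ.mkℚᵘ (ℤ.+ (a ℕ.* b)) 0                 ≈⟨ ℚᵘ.*≡* (cong (ℤ._* ℤ.1ℤ) (ℤ.pos-* a b)) ⟩
  ℚᵘ.mkℚᵘ (ℤ.+ a) 0 ℚᵘ.* ℚᵘ.mkℚᵘ (ℤ.+ b) 0  ≡⟨ cong₂ ℚᵘ._*_ (toℚᵘ-ℕtoℚ a) (toℚᵘ-ℕtoℚ b) ⟨
  toℚᵘ (ℕtoℚ a) ℚᵘ.* toℚᵘ (ℕtoℚ b)          ≈⟨ toℚᵘ-homo-* (ℕtoℚ a) (ℕtoℚ b) ⟨
  toℚᵘ (ℕtoℚ a * ℕtoℚ b)                    ∎)
  where open import Relation.Binary.Reasoning.Setoid ℚᵘ.≃-setoid

ℕtoℚ-mono-≤ : ∀ {a b} → a ℕ.≤ b → ℕtoℚ a ≤ ℕtoℚ b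
ℕtoℚ-mono-≤ {a} {b} a≤b = toℚᵘ-cancel-≤ (subst₂ ℚᵘ._≤_ (sym (toℚᵘ-ℕtoℚ a)) (sym (toℚᵘ-ℕtoℚ b))
  (ℚᵘ.*≤* (ℤ.*-monoʳ-≤-nonNeg ℤ.1ℤ (ℤ.+≤+ a≤b))))

ℕtoℚ-mono-< : ∀ {a b} → a ℕ.< b → ℕtoℚ a < ℕtoℚ b
ℕtoℚ-mono-< {a} {b} a<b = toℚᵘ-cancel-< (subst₂ ℚᵘ._<_ (sym (toℚᵘ-ℕtoℚ a)) (sym (toℚᵘ-ℕtoℚ b))
  (ℚᵘ.*<* (ℤ.*-monoʳ-<-pos ℤ.1ℤ (ℤ.+<+ a<b))))

0≤ℕtoℚ : ∀ n → 0ℚ ≤ ℕtoℚ n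
0≤ℕtoℚ n = ℕtoℚ-mono-≤ {0} {n} z≤n

0<ℕtoℚ-suc : ∀ n → 0ℚ < ℕtoℚ (suc n)
0<ℕtoℚ-suc n = ℕtoℚ-mono-< {0} {suc n} (s≤s z≤n)

ℕtoℚ-suc≢0 : ∀ n → ℕtoℚ (suc n) ≢ 0ℚ
ℕtoℚ-suc≢0 n eq = <-irrefl (sym eq) (0<ℕtoℚ-suc n)

ℕtoℚ-suc : ∀ n → ℕtoℚ (suc n) ≡ 1ℚ + ℕtoℚ n
ℕtoℚ-suc = ℕtoℚ-+ 1

inv-inverseˡ : ∀ p → p ≢ 0ℚ → inv p * p ≡ 1ℚ
inv-inverseˡ p p≢0 with p ℚ.≟ 0ℚ
... | yes p≡0 = ⊥-elim (p≢0 p≡0)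
... | no  p≢0 = *-inverseˡ p {{≢-nonZero p≢0}}

inv-inverseʳ : ∀ p → p ≢ 0ℚ → p * inv p ≡ 1ℚ
inv-inverseʳ p p≢0 = trans (*-comm p (inv p)) (inv-inverseˡ p p≢0)

c*x≡0⇒x≡0 : ∀ c x → c ≢ 0ℚ → c * x ≡ 0ℚ → x ≡ 0ℚ
c*x≡0⇒x≡0 c x c≢0 cx≡0 = begin
  x                 ≡⟨ *-identityˡ x ⟨
  1ℚ * x            ≡⟨ cong (_* x) (inv-inverseˡ c c≢0) ⟨
  inv c * c * x     ≡⟨ *-assoc (inv c) c x ⟩
  inv c * (c * x)   ≡⟨ cong (inv c *_) cx≡0 ⟩
  inv c * 0ℚ        ≡⟨ *-zeroʳ (inv c) ⟩
  0ℚ                ∎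
  where open ≡-Reasoning

inv*inv≡inv* : ∀ x y z c → x ≢ 0ℚ → y ≢ 0ℚ → z ≢ 0ℚ → z ≡ c * (x * y) → inv x * inv y ≡ inv z * c
inv*inv≡inv* x y z c x≢0 y≢0 z≢0 z≡cxy = begin
  inv x * inv y                             ≡⟨ *-identityˡ _ ⟨
  1ℚ * (inv x * inv y)                      ≡⟨ cong (_* (inv x * inv y)) (inv-inverseˡ z z≢0) ⟨
  (inv z * z) * (inv x * inv y)             ≡⟨ cong (λ w → (inv z * w) * (inv x * inv y)) z≡cxy ⟩
  (inv z * (c * (x * y))) * (inv x * inv y) ≡⟨ solve 6 (λ iz c x y ix iy → (iz :* (c :* (x :* y))) :* (ix :* iy) := (iz :* c) :* ((x :* ix) :* (y :* iy))) refl (inv z) c x y (inv x) (inv y) ⟩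
  (inv z * c) * ((x * inv x) * (y * inv y)) ≡⟨ cong₂ (λ a b → (inv z * c) * (a * b)) (inv-inverseʳ x x≢0) (inv-inverseʳ y y≢0) ⟩
  (inv z * c) * (1ℚ * 1ℚ)                   ≡⟨ *-identityʳ _ ⟩
  inv z * c                                 ∎
  where open ≡-Reasoning

module _ where
  open ≡-Reasoning

  sumTo-cong : ∀ n {f g : ℕ → ℚ} → (∀ i → i ℕ.< n → f i ≡ g i) → sumTo n f ≡ sumTo n g
  sumTo-cong zero    f≡g = refl
  sumTo-cong (suc n) f≡g = cong₂ _+_ (sumTo-cong n (λ i i<n → f≡g i (ℕ.m<n⇒m<1+n i<n))) (f≡g n ℕ.≤-refl)

  sumTo-ext : ∀ n {f g : ℕ → ℚ} → (∀ i → f i ≡ g i) → sumTo n f ≡ sumTo n g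
  sumTo-ext n f≡g = sumTo-cong n (λ i _ → f≡g i)

  sumTo-zero : ∀ n (f : ℕ → ℚ) → (∀ i → i ℕ.< n → f i ≡ 0ℚ) → sumTo n f ≡ 0ℚ
  sumTo-zero zero    f f≡0 = refl
  sumTo-zero (suc n) f f≡0 rewrite sumTo-zero n f (λ i i<n → f≡0 i (ℕ.m<n⇒m<1+n i<n)) | f≡0 n ℕ.≤-refl = refl

  sumTo-+ : ∀ n (f g : ℕ → ℚ) → sumTo n (λ i → f i + g i) ≡ sumTo n f + sumTo n g
  sumTo-+ zero    f g = refl
  sumTo-+ (suc n) f g rewrite sumTo-+ n f g =
    solve 4 (λ a b c d → (a :+ b) :+ (c :+ d) := (a :+ c) :+ (b :+ d)) refl (sumTo n f) (sumTo n g) (f n) (g n)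

  *-distribˡ-sumTo : ∀ n c (f : ℕ → ℚ) → c * sumTo n f ≡ sumTo n (λ i → c * f i)
  *-distribˡ-sumTo zero    c f = *-zeroʳ c
  *-distribˡ-sumTo (suc n) c f = trans (*-distribˡ-+ c (sumTo n f) (f n)) (cong (_+ c * f n) (*-distribˡ-sumTo n c f))

  *-distribʳ-sumTo : ∀ n c (f : ℕ → ℚ) → sumTo n f * c ≡ sumTo n (λ i → f i * c)
  *-distribʳ-sumTo n c f = trans (*-comm (sumTo n f) c) (trans (*-distribˡ-sumTo n c f) (sumTo-ext n (λ i → *-comm c (f i))))

  neg-distrib-sumTo : ∀ n (f : ℕ → ℚ) → - sumTo n f ≡ sumTo n (λ i → - f i)
  neg-distrib-sumTo zero    f = refl
  neg-distrib-sumTo (suc n) f rewrite sym (neg-distrib-sumTo n f) = neg-distrib-+ (sumTo n f) (f n)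

  sumTo-const : ∀ n c → sumTo n (λ _ → c) ≡ ℕtoℚ n * c
  sumTo-const zero    c = sym (*-zeroˡ c)
  sumTo-const (suc n) c rewrite sumTo-const n c | ℕtoℚ-suc n =
    solve 2 (λ x c → x :* c :+ c := (con 1ℚ :+ x) :* c) refl (ℕtoℚ n) c

  sumTo-suc-head : ∀ n (f : ℕ → ℚ) → sumTo (suc n) f ≡ f 0 + sumTo n (λ i → f (suc i))
  sumTo-suc-head zero    f = trans (+-identityˡ (f 0)) (sym (+-identityʳ (f 0)))
  sumTo-suc-head (suc n) f rewrite sumTo-suc-head n f = +-assoc (f 0) _ _

  sumTo-head-last : ∀ p (f : ℕ → ℚ) → (∀ i → i ℕ.< p → f (suc i) ≡ 0ℚ) →
    sumTo (suc (suc p)) f ≡ f 0 + f (suc p)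
  sumTo-head-last p f inner≡0 = begin
    sumTo (suc p) f + f (suc p)                   ≡⟨ cong (_+ f (suc p)) (sumTo-suc-head p f) ⟩
    (f 0 + sumTo p (λ i → f (suc i))) + f (suc p) ≡⟨ cong (λ s → (f 0 + s) + f (suc p)) (sumTo-zero p _ inner≡0) ⟩
    (f 0 + 0ℚ) + f (suc p)                        ≡⟨ cong (_+ f (suc p)) (+-identityʳ (f 0)) ⟩
    f 0 + f (suc p)                               ∎

  sumTo-reverse : ∀ n (f : ℕ → ℚ) → sumTo n f ≡ sumTo n (λ j → f (n ∸ suc j))
  sumTo-reverse zero    f = refl
  sumTo-reverse (suc n) f = begin
    sumTo n f + f n                         ≡⟨ cong (_+ f n) (sumTo-reverse n f) ⟩
    sumTo n (λ j → f (n ∸ suc j)) + f n     ≡⟨ +-comm _ (f n) ⟩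
    f n + sumTo n (λ j → f (n ∸ suc j))     ≡⟨ sumTo-suc-head n (λ j → f (n ∸ j)) ⟨
    sumTo (suc n) (λ j → f (n ∸ j))         ∎

  sumTo-mono-≤ : ∀ n {f g : ℕ → ℚ} → (∀ i → i ℕ.< n → f i ≤ g i) → sumTo n f ≤ sumTo n g
  sumTo-mono-≤ zero    f≤g = ≤-refl
  sumTo-mono-≤ (suc n) f≤g = +-mono-≤ (sumTo-mono-≤ n (λ i i<n → f≤g i (ℕ.m<n⇒m<1+n i<n))) (f≤g n ℕ.≤-refl)

  ∣sumTo∣≤sumTo∣∣ : ∀ n (f : ℕ → ℚ) → ∣ sumTo n f ∣ ≤ sumTo n (λ i → ∣ f i ∣)
  ∣sumTo∣≤sumTo∣∣ zero    f = ≤-refl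
  ∣sumTo∣≤sumTo∣∣ (suc n) f = ≤-trans (∣p+q∣≤∣p∣+∣q∣ (sumTo n f) (f n)) (+-monoˡ-≤ ∣ f n ∣ (∣sumTo∣≤sumTo∣∣ n f))

  sumTo-triangle : ∀ n (F : ℕ → ℕ → ℚ) →
    sumTo (suc n) (λ j → sumTo (suc j) (λ i → F i j)) ≡
    sumTo (suc n) (λ i → sumTo (suc (n ∸ i)) (λ l → F i (i ℕ.+ l)))
  sumTo-triangle zero    F = refl
  sumTo-triangle (suc n) F = begin
    Cols n + sumTo (suc (suc n)) (λ i → F i (suc n))
      ≡⟨ cong (_+ sumTo (suc (suc n)) (λ i → F i (suc n))) (sumTo-triangle n F) ⟩
    Rows n + (sumTo (suc n) (λ i → F i (suc n)) + F (suc n) (suc n))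
      ≡⟨ +-assoc (Rows n) _ _ ⟨
    (Rows n + sumTo (suc n) (λ i → F i (suc n))) + F (suc n) (suc n)
      ≡⟨ cong₂ _+_ (trans (sym (sumTo-+ (suc n) _ _)) (sumTo-cong (suc n) extendRow)) lastRow ⟩
    Rows (suc n) ∎
    where
    Cols Rows : ℕ → ℚ
    Cols n = sumTo (suc n) (λ j → sumTo (suc j) (λ i → F i j))
    Rows n = sumTo (suc n) (λ i → sumTo (suc (n ∸ i)) (λ l → F i (i ℕ.+ l)))
    lastRow : F (suc n) (suc n) ≡ sumTo (suc (n ∸ n)) (λ l → F (suc n) (suc n ℕ.+ l))
    lastRow rewrite ℕ.n∸n≡0 n | ℕ.+-identityʳ n = sym (+-identityˡ _)
    extendRow : ∀ i → i ℕ.< suc n →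
      sumTo (suc (n ∸ i)) (λ l → F i (i ℕ.+ l)) + F i (suc n) ≡ sumTo (suc (suc n ∸ i)) (λ l → F i (i ℕ.+ l))
    extendRow i (s≤s i≤n) rewrite ℕ.+-∸-assoc 1 i≤n =
      cong (_+_ (sumTo (suc (n ∸ i)) (λ l → F i (i ℕ.+ l))))
           (cong (F i) (sym (trans (ℕ.+-suc i (n ∸ i)) (cong suc (ℕ.m+[n∸m]≡n i≤n)))))

double : ℕ → ℕ
double zero    = zero
double (suc k) = suc (suc (double k))

double-∸ : ∀ a b → double a ∸ double b ≡ double (a ∸ b)
double-∸ a       zero    = refl
double-∸ zero    (suc b) = refl
double-∸ (suc a) (suc b) = double-∸ a b

suc-double-∸ : ∀ a b → b ℕ.≤ a → suc (double a) ∸ double b ≡ suc (double (a ∸ b))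
suc-double-∸ a       zero    _         = refl
suc-double-∸ (suc a) (suc b) (s≤s b≤a) = suc-double-∸ a b b≤a

sumTo-double : ∀ m (f : ℕ → ℚ) →
  sumTo (double m) f ≡ sumTo m (λ i → f (double i)) + sumTo m (λ i → f (suc (double i)))
sumTo-double zero    f = sym (+-identityʳ 0ℚ)
sumTo-double (suc m) f rewrite sumTo-double m f =
  solve 4 (λ a b c d → (a :+ b) :+ c :+ d := (a :+ c) :+ (b :+ d)) refl
    (sumTo m (λ i → f (double i))) (sumTo m (λ i → f (suc (double i)))) (f (double m)) (f (suc (double m)))

-- Formal power series

Series : Set
Series = ℕ → ℚ

infix 4 _≈_
_≈_ : Series → Series → Set
f ≈ g = ∀ n → f n ≡ g n

infixl 6 _⊕_
_⊕_ : Series → Series → Series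
(f ⊕ g) n = f n + g n

infix 25 ⊖_
⊖_ : Series → Series
(⊖ f) n = - f n

xSeries : Series
xSeries zero    = 0ℚ
xSeries (suc n) = oneSeries n

∂ : Series → Series
∂ f n = ℕtoℚ (suc n) * f (suc n)

module _ where
  open ≡-Reasoning

  ⊛-congˡ : ∀ {f f′} g → f ≈ f′ → (f ⊛ g) ≈ (f′ ⊛ g)
  ⊛-congˡ g f≈f′ n = sumTo-ext (suc n) (λ j → cong (_* g (n ∸ j)) (f≈f′ j))

  ⊛-congʳ : ∀ f {g g′} → g ≈ g′ → (f ⊛ g) ≈ (f ⊛ g′)
  ⊛-congʳ f g≈g′ n = sumTo-ext (suc n) (λ j → cong (f j *_) (g≈g′ (n ∸ j)))

  ⊛-comm : ∀ f g → (f ⊛ g) ≈ (g ⊛ f)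
  ⊛-comm f g n = trans (sumTo-reverse (suc n) (λ j → f j * g (n ∸ j)))
    (sumTo-cong (suc n) (λ j j≤n → trans (cong (λ i → f (n ∸ j) * g i) (ℕ.m∸[m∸n]≡n (ℕ.≤-pred j≤n)))
                                         (*-comm (f (n ∸ j)) (g j))))

  ⊛-assoc : ∀ f g h → ((f ⊛ g) ⊛ h) ≈ (f ⊛ (g ⊛ h))
  ⊛-assoc f g h n = begin
    sumTo (suc n) (λ j → sumTo (suc j) (λ i → f i * g (j ∸ i)) * h (n ∸ j))
      ≡⟨ sumTo-ext (suc n) (λ j → *-distribʳ-sumTo (suc j) (h (n ∸ j)) _) ⟩
    sumTo (suc n) (λ j → sumTo (suc j) (λ i → f i * g (j ∸ i) * h (n ∸ j)))
      ≡⟨ sumTo-triangle n (λ i j → f i * g (j ∸ i) * h (n ∸ j)) ⟩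
    sumTo (suc n) (λ i → sumTo (suc (n ∸ i)) (λ l → f i * g ((i ℕ.+ l) ∸ i) * h (n ∸ (i ℕ.+ l))))
      ≡⟨ sumTo-ext (suc n) (λ i → trans (sumTo-ext (suc (n ∸ i)) (reindex i)) (sym (*-distribˡ-sumTo (suc (n ∸ i)) (f i) _))) ⟩
    sumTo (suc n) (λ i → f i * sumTo (suc (n ∸ i)) (λ l → g l * h (n ∸ i ∸ l))) ∎
    where
    reindex : ∀ i l → f i * g ((i ℕ.+ l) ∸ i) * h (n ∸ (i ℕ.+ l)) ≡ f i * (g l * h (n ∸ i ∸ l))
    reindex i l = trans (cong₂ (λ a b → f i * g a * h b) (ℕ.m+n∸m≡n i l) (sym (ℕ.∸-+-assoc n i l)))
                        (*-assoc (f i) (g l) (h (n ∸ i ∸ l)))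

  ⊛-identityˡ : ∀ f → (oneSeries ⊛ f) ≈ f
  ⊛-identityˡ f n = begin
    sumTo (suc n) (λ j → oneSeries j * f (n ∸ j))        ≡⟨ sumTo-suc-head n _ ⟩
    1ℚ * f n + sumTo n (λ j → 0ℚ * f (n ∸ suc j))         ≡⟨ cong₂ _+_ (*-identityˡ (f n)) (sumTo-zero n _ (λ j _ → *-zeroˡ (f (n ∸ suc j)))) ⟩
    f n + 0ℚ                                             ≡⟨ +-identityʳ (f n) ⟩
    f n                                                  ∎

  ⊛-identityʳ : ∀ f → (f ⊛ oneSeries) ≈ f
  ⊛-identityʳ f n = trans (⊛-comm f oneSeries n) (⊛-identityˡ f n)

  xSeries-⊛-suc : ∀ f n → (xSeries ⊛ f) (suc n) ≡ f n
  xSeries-⊛-suc f n = begin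
    sumTo (suc (suc n)) (λ j → xSeries j * f (suc n ∸ j)) ≡⟨ sumTo-suc-head (suc n) _ ⟩
    0ℚ * f (suc n) + (oneSeries ⊛ f) n                    ≡⟨ cong₂ _+_ (*-zeroˡ (f (suc n))) (⊛-identityˡ f n) ⟩
    0ℚ + f n                                              ≡⟨ +-identityˡ (f n) ⟩
    f n                                                   ∎

  ⊛-distribʳ-⊕ : ∀ f g h → ((f ⊕ g) ⊛ h) ≈ ((f ⊛ h) ⊕ (g ⊛ h))
  ⊛-distribʳ-⊕ f g h n = trans (sumTo-ext (suc n) (λ j → *-distribʳ-+ (h (n ∸ j)) (f j) (g j))) (sumTo-+ (suc n) _ _)

  ⊛-distribˡ-⊕ : ∀ f g h → (f ⊛ (g ⊕ h)) ≈ ((f ⊛ g) ⊕ (f ⊛ h))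
  ⊛-distribˡ-⊕ f g h n = trans (sumTo-ext (suc n) (λ j → *-distribˡ-+ (f j) (g (n ∸ j)) (h (n ∸ j)))) (sumTo-+ (suc n) _ _)

  neg-distribˡ-⊛ : ∀ f g → ((⊖ f) ⊛ g) ≈ (⊖ (f ⊛ g))
  neg-distribˡ-⊛ f g n = trans (sumTo-ext (suc n) (λ j → sym (neg-distribˡ-* (f j) (g (n ∸ j)))))
                               (sym (neg-distrib-sumTo (suc n) _))

  ∂-leibniz : ∀ f g → ∂ (f ⊛ g) ≈ ((∂ f ⊛ g) ⊕ (f ⊛ ∂ g))
  ∂-leibniz f g n = begin
    ℕtoℚ (suc n) * sumTo (suc (suc n)) t                    ≡⟨ *-distribˡ-sumTo (suc (suc n)) (ℕtoℚ (suc n)) t ⟩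
    sumTo (suc (suc n)) (λ j → ℕtoℚ (suc n) * t j)           ≡⟨ sumTo-cong (suc (suc n)) splitWeight ⟩
    sumTo (suc (suc n)) (λ j → ℕtoℚ j * t j + ℕtoℚ (suc n ∸ j) * t j)
                                                            ≡⟨ sumTo-+ (suc (suc n)) _ _ ⟩
    sumTo (suc (suc n)) (λ j → ℕtoℚ j * t j) + sumTo (suc (suc n)) (λ j → ℕtoℚ (suc n ∸ j) * t j)
                                                            ≡⟨ cong₂ _+_ leftFactor rightFactor ⟩
    (∂ f ⊛ g) n + (f ⊛ ∂ g) n                               ∎
    where
    t : ℕ → ℚ
    t j = f j * g (suc n ∸ j)
    splitWeight : ∀ j → j ℕ.< suc (suc n) → ℕtoℚ (suc n) * t j ≡ ℕtoℚ j * t j + ℕtoℚ (suc n ∸ j) * t j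
    splitWeight j j≤sn = trans (cong (λ m → ℕtoℚ m * t j) (sym (ℕ.m+[n∸m]≡n (ℕ.≤-pred j≤sn))))
      (trans (cong (_* t j) (ℕtoℚ-+ j (suc n ∸ j))) (*-distribʳ-+ (t j) (ℕtoℚ j) _))
    leftFactor : sumTo (suc (suc n)) (λ j → ℕtoℚ j * t j) ≡ (∂ f ⊛ g) n
    leftFactor = begin
      sumTo (suc (suc n)) (λ j → ℕtoℚ j * t j)                        ≡⟨ sumTo-suc-head (suc n) _ ⟩
      0ℚ * t 0 + sumTo (suc n) (λ i → ℕtoℚ (suc i) * t (suc i))
        ≡⟨ cong₂ _+_ (*-zeroˡ (t 0)) (sumTo-ext (suc n) (λ i → sym (*-assoc (ℕtoℚ (suc i)) (f (suc i)) (g (n ∸ i))))) ⟩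
      0ℚ + (∂ f ⊛ g) n                                                ≡⟨ +-identityˡ _ ⟩
      (∂ f ⊛ g) n                                                     ∎
    rightFactor : sumTo (suc (suc n)) (λ j → ℕtoℚ (suc n ∸ j) * t j) ≡ (f ⊛ ∂ g) n
    rightFactor = begin
      sumTo (suc n) (λ j → ℕtoℚ (suc n ∸ j) * t j) + ℕtoℚ (suc n ∸ suc n) * t (suc n)
        ≡⟨ cong₂ _+_ (sumTo-cong (suc n) inner) (trans (cong (λ m → ℕtoℚ m * t (suc n)) (ℕ.n∸n≡0 n)) (*-zeroˡ (t (suc n)))) ⟩
      (f ⊛ ∂ g) n + 0ℚ                                               ≡⟨ +-identityʳ _ ⟩
      (f ⊛ ∂ g) n                                                    ∎
      where
      inner : ∀ j → j ℕ.< suc n → ℕtoℚ (suc n ∸ j) * t j ≡ f j * ∂ g (n ∸ j)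
      inner j j≤n rewrite ℕ.+-∸-assoc 1 (ℕ.≤-pred j≤n) =
        solve 3 (λ a b c → a :* (b :* c) := b :* (a :* c)) refl (ℕtoℚ (suc (n ∸ j))) (f j) (g (suc (n ∸ j)))

-- Bernoulli numbers

nth-∷ʳ-< : ∀ xs x j → j ℕ.< length xs → nth (xs ∷ʳ x) j ≡ nth xs j
nth-∷ʳ-< (y ∷ xs) x zero    _       = refl
nth-∷ʳ-< (y ∷ xs) x (suc j) (s≤s j<) = nth-∷ʳ-< xs x j j<

nth-∷ʳ-length : ∀ xs x {j} → length xs ≡ j → nth (xs ∷ʳ x) j ≡ x
nth-∷ʳ-length []       x refl = refl
nth-∷ʳ-length (y ∷ xs) x refl = nth-∷ʳ-length xs x refl

length-bernoulliList : ∀ n → length (bernoulliList n) ≡ suc n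
length-bernoulliList zero    = refl
length-bernoulliList (suc n) = trans (List.length-++ (bernoulliList n))
  (trans (cong (ℕ._+ 1) (length-bernoulliList n)) (ℕ.+-comm (suc n) 1))

nth-bernoulliList : ∀ n j → j ℕ.≤ n → nth (bernoulliList n) j ≡ bernoulli j
nth-bernoulliList zero    zero _   = refl
nth-bernoulliList (suc n) j j≤sn with ℕ.m≤n⇒m<n∨m≡n j≤sn
... | inj₂ refl      = refl
... | inj₁ (s≤s j≤n) = trans (nth-∷ʳ-< (bernoulliList n) _ j (subst (j ℕ.<_) (sym (length-bernoulliList n)) (s≤s j≤n)))
                             (nth-bernoulliList n j j≤n)

bernoulli-suc : ∀ n → bernoulli (suc n) ≡
  - (inv (ℕtoℚ (suc (suc n))) * sumTo (suc n) (λ j → ℕtoℚ (suc (suc n) C j) * bernoulli j))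
bernoulli-suc n = trans (nth-∷ʳ-length (bernoulliList n) _ (length-bernoulliList n))
  (cong (λ s → - (inv (ℕtoℚ (suc (suc n))) * s))
        (sumTo-cong (suc n) (λ j j≤n → cong (ℕtoℚ (suc (suc n) C j) *_) (nth-bernoulliList n j (ℕ.≤-pred j≤n)))))

bernoulli-binomialSum : ∀ n → sumTo (suc n) (λ j → ℕtoℚ (suc n C j) * bernoulli j) ≡ oneSeries n
bernoulli-binomialSum zero    = refl
bernoulli-binomialSum (suc n) = begin
  s + ℕtoℚ (suc (suc n) C suc n) * bernoulli (suc n) ≡⟨ cong₂ (λ a b → s + ℕtoℚ a * b) nCn-1≡n (bernoulli-suc n) ⟩
  s + c * - (inv c * s)                              ≡⟨ cong (s +_) (neg-distribʳ-* c (inv c * s)) ⟨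
  s + - (c * (inv c * s))                            ≡⟨ cong (λ w → s + - w) c*[c⁻¹*s]≡s ⟩
  s + - s                                            ≡⟨ +-inverseʳ s ⟩
  0ℚ                                                 ∎
  where
  open ≡-Reasoning
  s = sumTo (suc n) (λ j → ℕtoℚ (suc (suc n) C j) * bernoulli j)
  c = ℕtoℚ (suc (suc n))
  nCn-1≡n : suc (suc n) C suc n ≡ suc (suc n)
  nCn-1≡n = trans (nCk≡nC[n∸k] (ℕ.n≤1+n (suc n))) (trans (cong (suc (suc n) C_) (ℕ.m+n∸n≡m 1 (suc n))) (nC1≡n (suc (suc n))))
  c*[c⁻¹*s]≡s : c * (inv c * s) ≡ s
  c*[c⁻¹*s]≡s = trans (sym (*-assoc c (inv c) s)) (trans (cong (_* s) (inv-inverseʳ c (ℕtoℚ-suc≢0 (suc n)))) (*-identityˡ s))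

invFactorial : ℕ → ℚ
invFactorial n = inv (ℕtoℚ (n !))

ℕtoℚ-!≢0 : ∀ n → ℕtoℚ (n !) ≢ 0ℚ
ℕtoℚ-!≢0 n with n ! | ℕ.1≤n! n
... | suc k | _ = ℕtoℚ-suc≢0 k

invFactorial-split : ∀ m j → j ℕ.≤ m → invFactorial j * invFactorial (m ∸ j) ≡ invFactorial m * ℕtoℚ (m C j)
invFactorial-split m j j≤m = inv*inv≡inv* _ _ _ (ℕtoℚ (m C j)) (ℕtoℚ-!≢0 j) (ℕtoℚ-!≢0 (m ∸ j)) (ℕtoℚ-!≢0 m)
  (trans (cong ℕtoℚ m!≡mCj*[j!*[m-j]!])
         (trans (ℕtoℚ-* (m C j) _) (cong (ℕtoℚ (m C j) *_) (ℕtoℚ-* (j !) ((m ∸ j) !)))))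
  where
  m!≡mCj*[j!*[m-j]!] : m ! ≡ (m C j) ℕ.* (j ! ℕ.* (m ∸ j) !)
  m!≡mCj*[j!*[m-j]!] = sym (trans (cong (ℕ._* (j ! ℕ.* (m ∸ j) !)) (nCk≡n!/k![n-k]! j≤m))
                                  (m/n*n≡m {{ℕ._!*_!≢0 j (m ∸ j)}} (k![n∸k]!∣n! j≤m)))

β : Series
β n = bernoulli n * invFactorial n

expm1 : Series
expm1 zero    = 0ℚ
expm1 (suc n) = invFactorial (suc n)

β⊛expm1≈xSeries : (β ⊛ expm1) ≈ xSeries
β⊛expm1≈xSeries zero    = trans (+-identityˡ _) (*-zeroʳ (β 0))
β⊛expm1≈xSeries (suc m) = begin
  sumTo (suc m) (λ j → β j * expm1 (suc m ∸ j)) + β (suc m) * expm1 (suc m ∸ suc m)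
    ≡⟨ cong₂ _+_ (sumTo-cong (suc m) term) (trans (cong (λ k → β (suc m) * expm1 k) (ℕ.n∸n≡0 m)) (*-zeroʳ (β (suc m)))) ⟩
  sumTo (suc m) (λ j → invFactorial (suc m) * (ℕtoℚ (suc m C j) * bernoulli j)) + 0ℚ
    ≡⟨ +-identityʳ _ ⟩
  sumTo (suc m) (λ j → invFactorial (suc m) * (ℕtoℚ (suc m C j) * bernoulli j))
    ≡⟨ *-distribˡ-sumTo (suc m) (invFactorial (suc m)) _ ⟨
  invFactorial (suc m) * sumTo (suc m) (λ j → ℕtoℚ (suc m C j) * bernoulli j)
    ≡⟨ cong (invFactorial (suc m) *_) (bernoulli-binomialSum m) ⟩
  invFactorial (suc m) * oneSeries m
    ≡⟨ invFactorial-*-oneSeries m ⟩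
  oneSeries m ∎
  where
  open ≡-Reasoning
  term : ∀ j → j ℕ.< suc m → β j * expm1 (suc m ∸ j) ≡ invFactorial (suc m) * (ℕtoℚ (suc m C j) * bernoulli j)
  term j (s≤s j≤m) = begin
    bernoulli j * invFactorial j * expm1 (suc m ∸ j)          ≡⟨ cong (λ k → bernoulli j * invFactorial j * expm1 k) (ℕ.+-∸-assoc 1 j≤m) ⟩
    bernoulli j * invFactorial j * invFactorial (suc (m ∸ j)) ≡⟨ *-assoc (bernoulli j) (invFactorial j) _ ⟩
    bernoulli j * (invFactorial j * invFactorial (suc (m ∸ j))) ≡⟨ cong (λ k → bernoulli j * (invFactorial j * invFactorial k)) (ℕ.+-∸-assoc 1 j≤m) ⟨
    bernoulli j * (invFactorial j * invFactorial (suc m ∸ j))   ≡⟨ cong (bernoulli j *_) (invFactorial-split (suc m) j (ℕ.m≤n⇒m≤1+n j≤m)) ⟩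
    bernoulli j * (invFactorial (suc m) * ℕtoℚ (suc m C j))     ≡⟨ solve 3 (λ b i c → b :* (i :* c) := i :* (c :* b)) refl (bernoulli j) (invFactorial (suc m)) (ℕtoℚ (suc m C j)) ⟩
    invFactorial (suc m) * (ℕtoℚ (suc m C j) * bernoulli j)     ∎
  invFactorial-*-oneSeries : ∀ m → invFactorial (suc m) * oneSeries m ≡ oneSeries m
  invFactorial-*-oneSeries zero    = refl
  invFactorial-*-oneSeries (suc m) = *-zeroʳ (invFactorial (suc (suc m)))

∂expm1≈expm1⊕oneSeries : ∂ expm1 ≈ (expm1 ⊕ oneSeries)
∂expm1≈expm1⊕oneSeries zero    = refl
∂expm1≈expm1⊕oneSeries (suc m) = begin
  c * invFactorial (suc (suc m))   ≡⟨ *-comm c _ ⟩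
  invFactorial (suc (suc m)) * c   ≡⟨ inv*inv≡inv* 1ℚ _ _ c (λ ()) (ℕtoℚ-!≢0 (suc m)) (ℕtoℚ-!≢0 (suc (suc m))) [m+2]!≡c*[1*[m+1]!] ⟨
  inv 1ℚ * invFactorial (suc m)    ≡⟨ *-identityˡ _ ⟩
  invFactorial (suc m)             ≡⟨ +-identityʳ _ ⟨
  invFactorial (suc m) + 0ℚ        ∎
  where
  open ≡-Reasoning
  c = ℕtoℚ (suc (suc m))
  [m+2]!≡c*[1*[m+1]!] : ℕtoℚ (suc (suc m) !) ≡ c * (1ℚ * ℕtoℚ (suc m !))
  [m+2]!≡c*[1*[m+1]!] = trans (ℕtoℚ-* (suc (suc m)) (suc m !)) (cong (c *_) (sym (*-identityˡ _)))

∂xSeries≈oneSeries : ∂ xSeries ≈ oneSeries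
∂xSeries≈oneSeries zero    = refl
∂xSeries≈oneSeries (suc n) = *-zeroʳ (ℕtoℚ (suc (suc n)))

∂β⊛expm1 : ∀ n → (∂ β ⊛ expm1) n ≡ oneSeries n - (xSeries n + β n)
∂β⊛expm1 n = begin
  (∂ β ⊛ expm1) n                    ≡⟨ +-identityʳ _ ⟨
  (∂ β ⊛ expm1) n + 0ℚ               ≡⟨ cong ((∂ β ⊛ expm1) n +_) (+-inverseʳ y) ⟨
  (∂ β ⊛ expm1) n + (y - y)          ≡⟨ +-assoc ((∂ β ⊛ expm1) n) y (- y) ⟨
  ((∂ β ⊛ expm1) n + y) - y          ≡⟨ cong (_- y) (∂-leibniz β expm1 n) ⟨
  ∂ (β ⊛ expm1) n - y                ≡⟨ cong (λ w → ℕtoℚ (suc n) * w - y) (β⊛expm1≈xSeries (suc n)) ⟩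
  ∂ xSeries n - y                    ≡⟨ cong₂ _-_ (∂xSeries≈oneSeries n) y≡x+β ⟩
  oneSeries n - (xSeries n + β n)    ∎
  where
  open ≡-Reasoning
  y = (β ⊛ ∂ expm1) n
  y≡x+β : y ≡ xSeries n + β n
  y≡x+β = trans (⊛-congʳ β ∂expm1≈expm1⊕oneSeries n)
         (trans (⊛-distribˡ-⊕ β expm1 oneSeries n) (cong₂ _+_ (β⊛expm1≈xSeries n) (⊛-identityʳ β n)))

-- The coefficients of x B′ = B − x B − B², obtained by differentiating B (eˣ − 1) = x.
riccati : ∀ m → ℕtoℚ (suc m) * β (suc m) ≡ β (suc m) - β m - (β ⊛ β) (suc m)
riccati m = begin
  ℕtoℚ (suc m) * β (suc m)                          ≡⟨ xSeries-⊛-suc (∂ β) m ⟨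
  (xSeries ⊛ ∂ β) (suc m)                           ≡⟨ ⊛-comm xSeries (∂ β) (suc m) ⟩
  (∂ β ⊛ xSeries) (suc m)                           ≡⟨ ⊛-congʳ (∂ β) (λ k → trans (⊛-comm expm1 β k) (β⊛expm1≈xSeries k)) (suc m) ⟨
  (∂ β ⊛ (expm1 ⊛ β)) (suc m)                       ≡⟨ ⊛-assoc (∂ β) expm1 β (suc m) ⟨
  ((∂ β ⊛ expm1) ⊛ β) (suc m)                       ≡⟨ ⊛-congˡ β ∂β⊛expm1 (suc m) ⟩
  ((oneSeries ⊕ ⊖ (xSeries ⊕ β)) ⊛ β) (suc m)       ≡⟨ ⊛-distribʳ-⊕ oneSeries (⊖ (xSeries ⊕ β)) β (suc m) ⟩
  (oneSeries ⊛ β) (suc m) + (⊖ (xSeries ⊕ β) ⊛ β) (suc m)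
                                                    ≡⟨ cong₂ _+_ (⊛-identityˡ β (suc m)) (neg-distribˡ-⊛ (xSeries ⊕ β) β (suc m)) ⟩
  β (suc m) - ((xSeries ⊕ β) ⊛ β) (suc m)           ≡⟨ cong (_-_ (β (suc m))) (⊛-distribʳ-⊕ xSeries β β (suc m)) ⟩
  β (suc m) - ((xSeries ⊛ β) (suc m) + (β ⊛ β) (suc m))
                                                    ≡⟨ cong (λ w → β (suc m) - (w + (β ⊛ β) (suc m))) (xSeries-⊛-suc β m) ⟩
  β (suc m) - (β m + (β ⊛ β) (suc m))               ≡⟨ solve 3 (λ a b c → a :+ (:- (b :+ c)) := (a :+ (:- b)) :+ (:- c)) refl (β (suc m)) (β m) ((β ⊛ β) (suc m)) ⟩
  β (suc m) - β m - (β ⊛ β) (suc m)                 ∎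
  where open ≡-Reasoning

β-one : β 1 ≡ - ½
β-one = refl

β⊛β-odd : ∀ p → (∀ {i} → i ℕ.< p → β (suc (double (suc i))) ≡ 0ℚ) →
  (β ⊛ β) (suc (double (suc p))) ≡ β (suc (double (suc p))) + β (suc (double (suc p))) - β (double (suc p))
β⊛β-odd p β-odd< = begin
  (β ⊛ β) (suc (double k))            ≡⟨ sumTo-double (suc k) t ⟩
  sumTo (suc k) (λ i → t (double i)) + sumTo (suc k) (λ i → t (suc (double i)))
                                      ≡⟨ cong₂ _+_ evenTerms oddTerms ⟩
  (x + a * β 1) + (β 1 * a + x)       ≡⟨ cong (λ b → (x + a * b) + (b * a + x)) β-one ⟩
  (x + a * - ½) + (- ½ * a + x)       ≡⟨ solve 2 (λ x a → (x :+ a :* con (- ½)) :+ (con (- ½) :* a :+ x) := x :+ x :+ (:- a)) refl x a ⟩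
  x + x - a                           ∎
  where
  open ≡-Reasoning
  k = suc p
  x = β (suc (double k))
  a = β (double k)
  t : ℕ → ℚ
  t j = β j * β (suc (double k) ∸ j)
  u : ℕ → ℚ
  u i = β (double i) * β (suc (double (k ∸ i)))
  β-odd-inner : ∀ i → i ℕ.< p → β (suc (double (p ∸ i))) ≡ 0ℚ
  β-odd-inner i i<p = subst (λ m → β (suc (double m)) ≡ 0ℚ) (sym p∸i≡1+p∸[1+i]) (β-odd< (subst (ℕ._≤ p) p∸i≡1+p∸[1+i] (ℕ.m∸n≤m p i)))
    where
    p∸i≡1+p∸[1+i] : p ∸ i ≡ suc (p ∸ suc i)
    p∸i≡1+p∸[1+i] = ℕ.+-∸-assoc 1 i<p
  evenTerms : sumTo (suc k) (λ i → t (double i)) ≡ x + a * β 1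
  evenTerms = begin
    sumTo (suc k) (λ i → t (double i))
      ≡⟨ sumTo-cong (suc k) (λ i i≤k → cong (λ w → β (double i) * β w) (suc-double-∸ k i (ℕ.≤-pred i≤k))) ⟩
    sumTo (suc (suc p)) u
      ≡⟨ sumTo-head-last p u (λ i i<p → trans (cong (β (double (suc i)) *_) (β-odd-inner i i<p)) (*-zeroʳ (β (double (suc i))))) ⟩
    β 0 * x + a * β (suc (double (p ∸ p)))
      ≡⟨ cong₂ _+_ (*-identityˡ x) (cong (λ w → a * β (suc (double w))) (ℕ.n∸n≡0 p)) ⟩
    x + a * β 1 ∎
  oddTerms : sumTo (suc k) (λ i → t (suc (double i))) ≡ β 1 * a + x
  oddTerms = begin
    sumTo (suc k) (λ i → t (suc (double i)))
      ≡⟨ sumTo-head-last p (λ i → t (suc (double i))) (λ i i<p → trans (cong (_* β (double k ∸ double (suc i))) (β-odd< i<p)) (*-zeroˡ (β (double k ∸ double (suc i))))) ⟩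
    β 1 * a + x * β (double k ∸ double k)
      ≡⟨ cong (λ w → β 1 * a + x * β w) (ℕ.n∸n≡0 (double k)) ⟩
    β 1 * a + x * β 0
      ≡⟨ cong (_+_ (β 1 * a)) (*-identityʳ x) ⟩
    β 1 * a + x ∎

β-odd : ∀ p → β (suc (double (suc p))) ≡ 0ℚ
β-odd = <-rec _ λ p β-odd< → c*x≡0⇒x≡0 _ _ (ℕtoℚ-suc≢0 (suc (double (suc p)))) (riccati-odd p β-odd<)
  where
  riccati-odd : ∀ p → (∀ {i} → i ℕ.< p → β (suc (double (suc i))) ≡ 0ℚ) →
    ℕtoℚ (suc (suc (double (suc p)))) * β (suc (double (suc p))) ≡ 0ℚ
  riccati-odd p β-odd< = begin
    ℕtoℚ (suc (suc (double k))) * x          ≡⟨ cong (_* x) (ℕtoℚ-suc (suc (double k))) ⟩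
    (1ℚ + ℕtoℚ (suc (double k))) * x         ≡⟨ *-distribʳ-+ x 1ℚ (ℕtoℚ (suc (double k))) ⟩
    1ℚ * x + ℕtoℚ (suc (double k)) * x       ≡⟨ cong₂ _+_ (*-identityˡ x) (riccati (double k)) ⟩
    x + (x - a - (β ⊛ β) (suc (double k)))  ≡⟨ cong (λ w → x + (x - a - w)) (β⊛β-odd p β-odd<) ⟩
    x + (x - a - (x + x - a))               ≡⟨ solve 2 (λ x a → x :+ (x :+ (:- a) :+ (:- (x :+ x :+ (:- a)))) := con 0ℚ) refl x a ⟩
    0ℚ                                      ∎
    where
    open ≡-Reasoning
    k = suc p
    x = β (suc (double k))
    a = β (double k)

-- Growth of Bernoulli numbers

α : ℕ → ℚ
α k = β (double k)

α-rec : ∀ p → ℕtoℚ (suc (double (suc (suc p)))) * α (suc (suc p)) ≡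
  - sumTo (suc p) (λ i → α (suc i) * α (suc p ∸ i))
α-rec p = begin
  ℕtoℚ (suc (double k)) * a                     ≡⟨ cong (_* a) (ℕtoℚ-suc (double k)) ⟩
  (1ℚ + ℕtoℚ (double k)) * a                    ≡⟨ *-distribʳ-+ a 1ℚ (ℕtoℚ (double k)) ⟩
  1ℚ * a + ℕtoℚ (double k) * a                  ≡⟨ cong₂ _+_ (*-identityˡ a) (riccati (suc (double (suc p)))) ⟩
  a + (a - β (suc (double (suc p))) - (β ⊛ β) (double k))
                                                ≡⟨ cong₂ (λ u v → a + (a - u - v)) (β-odd p) β⊛β≡ ⟩
  a + (a - 0ℚ - ((a + T) + 0ℚ + a))             ≡⟨ solve 2 (λ a t → a :+ (a :+ (:- con 0ℚ) :+ (:- ((a :+ t) :+ con 0ℚ :+ a))) := :- t) refl a T ⟩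
  - T                                           ∎
  where
  open ≡-Reasoning
  k = suc (suc p)
  a = α k
  T = sumTo (suc p) (λ i → α (suc i) * α (suc p ∸ i))
  t : ℕ → ℚ
  t j = β j * β (double k ∸ j)
  evenTerms : sumTo k (λ i → t (double i)) ≡ a + T
  evenTerms = begin
    sumTo k (λ i → t (double i))        ≡⟨ sumTo-ext k (λ i → cong (λ w → β (double i) * β w) (double-∸ k i)) ⟩
    sumTo k (λ i → α i * α (k ∸ i))     ≡⟨ sumTo-suc-head (suc p) (λ i → α i * α (k ∸ i)) ⟩
    β 0 * a + T                         ≡⟨ cong (_+ T) (*-identityˡ a) ⟩
    a + T                               ∎
  oddTerms : sumTo k (λ i → t (suc (double i))) ≡ 0ℚ
  oddTerms = sumTo-zero k (λ i → t (suc (double i))) oddTerm≡0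
    where
    oddTerm≡0 : ∀ i → i ℕ.< k → t (suc (double i)) ≡ 0ℚ
    oddTerm≡0 zero    _ = trans (cong (β 1 *_) (β-odd p)) (*-zeroʳ (β 1))
    oddTerm≡0 (suc i) _ = trans (cong (_* β (double k ∸ suc (double (suc i)))) (β-odd i))
                                (*-zeroˡ (β (double k ∸ suc (double (suc i)))))
  β⊛β≡ : (β ⊛ β) (double k) ≡ (a + T) + 0ℚ + a
  β⊛β≡ = cong₂ _+_ (trans (sumTo-double k t) (cong₂ _+_ evenTerms oddTerms))
                   (trans (cong (λ w → a * β w) (ℕ.n∸n≡0 (double k))) (*-identityʳ a))

sign : ℕ → ℚ
sign zero    = - 1ℚ
sign (suc k) = - sign k

sign-+ : ∀ a b → sign (a ℕ.+ b) ≡ - (sign a * sign b)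
sign-+ zero    b = solve 1 (λ x → x := :- (:- con 1ℚ :* x)) refl (sign b)
sign-+ (suc a) b = trans (cong -_ (sign-+ a b)) (solve 2 (λ x y → :- (:- (x :* y)) := :- ((:- x) :* y)) refl (sign a) (sign b))

sign*sign : ∀ k → sign k * sign k ≡ 1ℚ
sign*sign zero    = refl
sign*sign (suc k) = trans (solve 1 (λ x → (:- x) :* (:- x) := x :* x) refl (sign k)) (sign*sign k)

∣sign∣ : ∀ k → ∣ sign k ∣ ≡ 1ℚ
∣sign∣ zero    = refl
∣sign∣ (suc k) = trans (∣-p∣≡∣p∣ (sign k)) (∣sign∣ k)

α⁺ : ℕ → ℚ
α⁺ k = sign k * α k

α≡sign*α⁺ : ∀ k → α k ≡ sign k * α⁺ k
α≡sign*α⁺ k = sym (trans (sym (*-assoc (sign k) (sign k) (α k))) (trans (cong (_* α k) (sign*sign k)) (*-identityˡ (α k))))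

W : ℕ → ℚ
W k = ℕtoℚ (60 ^ k) * α⁺ k

sign*α*α≡α⁺*α⁺ : ∀ a b → sign (a ℕ.+ b) * - (α a * α b) ≡ α⁺ a * α⁺ b
sign*α*α≡α⁺*α⁺ a b = begin
  sign (a ℕ.+ b) * - (α a * α b)
    ≡⟨ cong₂ (λ u v → u * - v) (sign-+ a b) (cong₂ _*_ (α≡sign*α⁺ a) (α≡sign*α⁺ b)) ⟩
  - (sign a * sign b) * - ((sign a * α⁺ a) * (sign b * α⁺ b))
    ≡⟨ solve 4 (λ x y u v → (:- (x :* y)) :* (:- ((x :* u) :* (y :* v))) := (x :* x) :* (y :* y) :* (u :* v)) refl (sign a) (sign b) (α⁺ a) (α⁺ b) ⟩
  (sign a * sign a) * (sign b * sign b) * (α⁺ a * α⁺ b)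
    ≡⟨ cong₂ (λ u v → u * v * (α⁺ a * α⁺ b)) (sign*sign a) (sign*sign b) ⟩
  1ℚ * 1ℚ * (α⁺ a * α⁺ b)
    ≡⟨ *-identityˡ _ ⟩
  α⁺ a * α⁺ b ∎
  where open ≡-Reasoning

W-rec : ∀ p → ℕtoℚ (suc (double (suc (suc p)))) * W (suc (suc p)) ≡ sumTo (suc p) (λ i → W (suc i) * W (suc p ∸ i))
W-rec p = begin
  c * (E k * α⁺ k)                                      ≡⟨ solve 3 (λ c e x → c :* (e :* x) := e :* (x :* c)) refl c (E k) (α⁺ k) ⟩
  E k * (sign k * α k * c)                              ≡⟨ cong (E k *_) (trans (*-assoc (sign k) (α k) c) (cong (sign k *_) (trans (*-comm (α k) c) (α-rec p)))) ⟩
  E k * (sign k * - sumTo (suc p) αα)                   ≡⟨ cong (λ w → E k * (sign k * w)) (neg-distrib-sumTo (suc p) αα) ⟩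
  E k * (sign k * sumTo (suc p) (λ i → - αα i))         ≡⟨ cong (E k *_) (*-distribˡ-sumTo (suc p) (sign k) _) ⟩
  E k * sumTo (suc p) (λ i → sign k * - αα i)           ≡⟨ *-distribˡ-sumTo (suc p) (E k) _ ⟩
  sumTo (suc p) (λ i → E k * (sign k * - αα i))         ≡⟨ sumTo-cong (suc p) term ⟩
  sumTo (suc p) (λ i → W (suc i) * W (suc p ∸ i))       ∎
  where
  open ≡-Reasoning
  k = suc (suc p)
  c = ℕtoℚ (suc (double k))
  E : ℕ → ℚ
  E j = ℕtoℚ (60 ^ j)
  αα : ℕ → ℚ
  αα i = α (suc i) * α (suc p ∸ i)
  term : ∀ i → i ℕ.< suc p → E k * (sign k * - αα i) ≡ W (suc i) * W (suc p ∸ i)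
  term i i≤p = begin
    E k * (sign k * - αα i)
      ≡⟨ cong (λ m → E m * (sign m * - αα i)) (sym i+1+[p+1-i]≡k) ⟩
    E (suc i ℕ.+ (suc p ∸ i)) * (sign (suc i ℕ.+ (suc p ∸ i)) * - αα i)
      ≡⟨ cong₂ _*_ (trans (cong ℕtoℚ (ℕ.^-distribˡ-+-* 60 (suc i) (suc p ∸ i))) (ℕtoℚ-* (60 ^ suc i) (60 ^ (suc p ∸ i))))
                   (sign*α*α≡α⁺*α⁺ (suc i) (suc p ∸ i)) ⟩
    (E (suc i) * E (suc p ∸ i)) * (α⁺ (suc i) * α⁺ (suc p ∸ i))
      ≡⟨ solve 4 (λ a b x y → (a :* b) :* (x :* y) := (a :* x) :* (b :* y)) refl (E (suc i)) (E (suc p ∸ i)) (α⁺ (suc i)) (α⁺ (suc p ∸ i)) ⟩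
    W (suc i) * W (suc p ∸ i) ∎
    where
    i+1+[p+1-i]≡k : suc i ℕ.+ (suc p ∸ i) ≡ k
    i+1+[p+1-i]≡k = cong suc (ℕ.m+[n∸m]≡n (ℕ.m≤n⇒m≤1+n (ℕ.≤-pred i≤p)))

W-one : W 1 ≡ ℕtoℚ 5
W-one = refl

25≤x*y : ∀ x y → ℕtoℚ 5 ≤ x → ℕtoℚ 5 ≤ y → ℕtoℚ 25 ≤ x * y
25≤x*y x y 5≤x 5≤y = ≤-trans (*-monoʳ-≤-nonNeg (ℕtoℚ 5) {{nonNegative (0≤ℕtoℚ 5)}} 5≤x)
  (*-monoˡ-≤-nonNeg x {{nonNegative (≤-trans (0≤ℕtoℚ 5) 5≤x)}} 5≤y)

[2k+1]*5≤[k-1]*25 : ∀ q → suc (double (suc (suc q))) ℕ.* 5 ℕ.≤ suc q ℕ.* 25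
[2k+1]*5≤[k-1]*25 zero    = ℕ.≤-refl
[2k+1]*5≤[k-1]*25 (suc q) = ℕ.+-mono-≤ {10} {25} (ℕ.m≤m+n 10 15) ([2k+1]*5≤[k-1]*25 q)

-- The scale 60 makes W 1 = 5, the least value that W-rec reproduces as a lower bound.
5≤W : ∀ p → ℕtoℚ 5 ≤ W (suc p)
5≤W = <-rec _ step
  where
  step : ∀ p → (∀ {i} → i ℕ.< p → ℕtoℚ 5 ≤ W (suc i)) → ℕtoℚ 5 ≤ W (suc p)
  step zero    _    = ≤-reflexive (sym W-one)
  step (suc q) 5≤W< = *-cancelˡ-≤-pos c {{positive (0<ℕtoℚ-suc (double k))}} (begin
    c * ℕtoℚ 5                                        ≡⟨ ℕtoℚ-* (suc (double k)) 5 ⟨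
    ℕtoℚ (suc (double k) ℕ.* 5)                       ≤⟨ ℕtoℚ-mono-≤ ([2k+1]*5≤[k-1]*25 q) ⟩
    ℕtoℚ (suc q ℕ.* 25)                               ≡⟨ trans (ℕtoℚ-* (suc q) 25) (sym (sumTo-const (suc q) (ℕtoℚ 25))) ⟩
    sumTo (suc q) (λ _ → ℕtoℚ 25)                     ≤⟨ sumTo-mono-≤ (suc q) 25≤WW ⟩
    sumTo (suc q) (λ i → W (suc i) * W (suc q ∸ i))   ≡⟨ W-rec q ⟨
    c * W k                                           ∎)
    where
    open ≤-Reasoning
    k = suc (suc q)
    c = ℕtoℚ (suc (double k))
    25≤WW : ∀ i → i ℕ.< suc q → ℕtoℚ 25 ≤ W (suc i) * W (suc q ∸ i)
    25≤WW i (s≤s i≤q) = 25≤x*y _ _ (5≤W< (s≤s i≤q))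
      (subst (λ j → ℕtoℚ 5 ≤ W j) (sym (ℕ.+-∸-assoc 1 i≤q)) (5≤W< (s≤s (ℕ.m∸n≤m q i))))

0≤α⁺ : ∀ p → 0ℚ ≤ α⁺ (suc p)
0≤α⁺ p = *-cancelˡ-≤-pos (ℕtoℚ (60 ^ suc p)) {{positive (ℕtoℚ-mono-< {0} {60 ^ suc p} (ℕ.m^n>0 60 (suc p)))}}
  (≤-trans (≤-reflexive (*-zeroʳ (ℕtoℚ (60 ^ suc p)))) (≤-trans (0≤ℕtoℚ 5) (5≤W p)))

∣α∣≡α⁺ : ∀ p → ∣ α (suc p) ∣ ≡ α⁺ (suc p)
∣α∣≡α⁺ p = begin
  ∣ α (suc p) ∣                     ≡⟨ cong ∣_∣ (α≡sign*α⁺ (suc p)) ⟩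
  ∣ sign (suc p) * α⁺ (suc p) ∣     ≡⟨ ∣p*q∣≡∣p∣*∣q∣ (sign (suc p)) (α⁺ (suc p)) ⟩
  ∣ sign (suc p) ∣ * ∣ α⁺ (suc p) ∣ ≡⟨ cong₂ _*_ (∣sign∣ (suc p)) (0≤p⇒∣p∣≡p (0≤α⁺ p)) ⟩
  1ℚ * α⁺ (suc p)                   ≡⟨ *-identityˡ _ ⟩
  α⁺ (suc p)                        ∎
  where open ≡-Reasoning

bernoulli≡β*! : ∀ k → bernoulli k ≡ β k * ℕtoℚ (k !)
bernoulli≡β*! k = sym (trans (*-assoc (bernoulli k) (invFactorial k) (ℕtoℚ (k !)))
  (trans (cong (bernoulli k *_) (inv-inverseˡ (ℕtoℚ (k !)) (ℕtoℚ-!≢0 k))) (*-identityʳ _)))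

bernoulli-double-lowerBound : ∀ p → ℕtoℚ (double (suc p) !) ≤ ℕtoℚ (60 ^ suc p) * ∣ bernoulli (double (suc p)) ∣
bernoulli-double-lowerBound p = begin
  ℕtoℚ (k !)                              ≡⟨ *-identityˡ _ ⟨
  1ℚ * ℕtoℚ (k !)                         ≤⟨ *-monoʳ-≤-nonNeg (ℕtoℚ (k !)) {{nonNegative (0≤ℕtoℚ (k !))}} (≤-trans (ℕtoℚ-mono-≤ {1} {5} (s≤s z≤n)) (5≤W p)) ⟩
  W h * ℕtoℚ (k !)                        ≡⟨ *-assoc E (α⁺ h) (ℕtoℚ (k !)) ⟩
  E * (α⁺ h * ℕtoℚ (k !))                 ≡⟨ cong (λ w → E * (w * ℕtoℚ (k !))) (∣α∣≡α⁺ p) ⟨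
  E * (∣ α h ∣ * ℕtoℚ (k !))              ≡⟨ cong (λ w → E * (∣ α h ∣ * w)) (0≤p⇒∣p∣≡p (0≤ℕtoℚ (k !))) ⟨
  E * (∣ α h ∣ * ∣ ℕtoℚ (k !) ∣)          ≡⟨ cong (E *_) (∣p*q∣≡∣p∣*∣q∣ (α h) (ℕtoℚ (k !))) ⟨
  E * ∣ α h * ℕtoℚ (k !) ∣                ≡⟨ cong (λ w → E * ∣ w ∣) (bernoulli≡β*! k) ⟨
  E * ∣ bernoulli k ∣                     ∎
  where
  open ≤-Reasoning
  h = suc p
  k = double h
  E = ℕtoℚ (60 ^ h)

bernoulli-double≢0 : ∀ p → bernoulli (double (suc p)) ≢ 0ℚ
bernoulli-double≢0 p B≡0 = <-irrefl refl (begin-strict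
  0ℚ                                          <⟨ ℕtoℚ-mono-< {0} {double (suc p) !} (ℕ.1≤n! (double (suc p))) ⟩
  ℕtoℚ (double (suc p) !)                     ≤⟨ bernoulli-double-lowerBound p ⟩
  ℕtoℚ (60 ^ suc p) * ∣ bernoulli (double (suc p)) ∣ ≡⟨ cong (λ w → ℕtoℚ (60 ^ suc p) * ∣ w ∣) B≡0 ⟩
  ℕtoℚ (60 ^ suc p) * 0ℚ                      ≡⟨ *-zeroʳ (ℕtoℚ (60 ^ suc p)) ⟩
  0ℚ                                          ∎)
  where open ≤-Reasoning

-- Bounds on Fourier coefficients

module _ where
  open ℕ.≤-Reasoning

  ^-double : ∀ n h → n ^ double h ≡ (n ℕ.* n) ^ h
  ^-double n zero    = refl
  ^-double n (suc h) = trans (sym (ℕ.*-assoc n n (n ^ double h))) (cong (ℕ._*_ (n ℕ.* n)) (^-double n h))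

  ^-distribʳ-* : ∀ a b h → (a ℕ.* b) ^ h ≡ a ^ h ℕ.* b ^ h
  ^-distribʳ-* a b zero    = refl
  ^-distribʳ-* a b (suc h) = trans (cong (ℕ._*_ (a ℕ.* b)) (^-distribʳ-* a b h)) (ℕ.[m*n]*[o*p]≡[m*o]*[n*p] a b (a ^ h) (b ^ h))

  2*double≤4*4^ : ∀ h → 2 ℕ.* double h ℕ.≤ 4 ℕ.* 4 ^ h
  2*double≤4*4^ zero    = z≤n
  2*double≤4*4^ (suc h) = begin
    2 ℕ.* double (suc h)             ≡⟨ ℕ.*-distribˡ-+ 2 2 (double h) ⟩
    4 ℕ.+ 2 ℕ.* double h             ≤⟨ ℕ.+-mono-≤ (ℕ.*-monoʳ-≤ 4 (ℕ.m^n>0 4 h)) (2*double≤4*4^ h) ⟩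
    4 ℕ.* 4 ^ h ℕ.+ 4 ℕ.* 4 ^ h        ≤⟨ ℕ.m≤m+n (4 ℕ.* 4 ^ h ℕ.+ 4 ℕ.* 4 ^ h) (2 ℕ.* (4 ℕ.* 4 ^ h)) ⟩
    4 ℕ.* 4 ^ h ℕ.+ 4 ℕ.* 4 ^ h ℕ.+ 2 ℕ.* (4 ℕ.* 4 ^ h) ≡⟨ 16x≡4*4x (4 ^ h) ⟩
    4 ℕ.* 4 ^ suc h                ∎
    where
    16x≡4*4x : ∀ x → 4 ℕ.* x ℕ.+ 4 ℕ.* x ℕ.+ 2 ℕ.* (4 ℕ.* x) ≡ 4 ℕ.* (4 ℕ.* x)
    16x≡4*4x = solve-∀

  ^≤^*! : ∀ a h → a ^ h ℕ.≤ a ^ a ℕ.* h !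
  ^≤^*! zero    zero    = s≤s z≤n
  ^≤^*! (suc a) zero    = ℕ.≤-trans (ℕ.m^n>0 (suc a) (suc a)) (ℕ.m≤m*n (suc a ^ suc a) 1)
  ^≤^*! a       (suc h) with a ℕ.≤? suc h
  ... | yes a≤1+h = begin
    a ℕ.* a ^ h                ≤⟨ ℕ.*-mono-≤ a≤1+h (^≤^*! a h) ⟩
    suc h ℕ.* (a ^ a ℕ.* h !)    ≡⟨ swap (suc h) (a ^ a) (h !) ⟩
    a ^ a ℕ.* (suc h ℕ.* h !)    ∎
    where
    swap : ∀ x y z → x ℕ.* (y ℕ.* z) ≡ y ℕ.* (x ℕ.* z)
    swap = solve-∀
  ... | no  a≰1+h = ℕ.≤-trans (ℕ.^-monoʳ-≤ a {{a≢0}} (ℕ.≰⇒≥ a≰1+h)) (ℕ.m≤m*n (a ^ a) (suc h !) {{suc h ℕ.!≢0}})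
    where
    a≢0 : ℕ.NonZero a
    a≢0 = ℕ.>-nonZero (ℕ.≤-trans (s≤s z≤n) (ℕ.≰⇒> a≰1+h))

  !≤double! : ∀ h → h ! ℕ.≤ double h !
  !≤double! h = subst (λ m → h ! ℕ.≤ m !) (sym (double≡+ h)) (!-mono h h)
    where
    double≡+ : ∀ h → double h ≡ h ℕ.+ h
    double≡+ zero    = refl
    double≡+ (suc h) = cong suc (trans (cong suc (double≡+ h)) (sym (ℕ.+-suc h h)))
    !-mono : ∀ a k → a ! ℕ.≤ (k ℕ.+ a) !
    !-mono a zero    = ℕ.≤-refl
    !-mono a (suc k) = ℕ.≤-trans (!-mono a k) (ℕ.m≤n*m ((k ℕ.+ a) !) (suc (k ℕ.+ a)))

  coeffBase : ℕ → ℕ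
  coeffBase n = 4 ℕ.* (60 ℕ.* (n ℕ.* n))

  coeffBound : ℕ → ℕ
  coeffBound n = 4 ℕ.* coeffBase n ^ coeffBase n

  1≤coeffBound : ∀ n → 1 ℕ.≤ coeffBound n
  1≤coeffBound n = begin
    1                     ≤⟨ ^≤^*! q 0 ⟩
    q ^ q ℕ.* 1           ≡⟨ ℕ.*-identityʳ (q ^ q) ⟩
    q ^ q                 ≤⟨ ℕ.m≤n*m (q ^ q) 4 ⟩
    coeffBound n          ∎
    where q = coeffBase n

  60^h*2k*m^k≤k!*coeffBound : ∀ n h m → m ℕ.≤ n → 60 ^ h ℕ.* (2 ℕ.* double h) ℕ.* m ^ double h ℕ.≤ double h ! ℕ.* coeffBound n
  60^h*2k*m^k≤k!*coeffBound n h m m≤n = begin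
    60 ^ h ℕ.* (2 ℕ.* double h) ℕ.* m ^ double h  ≤⟨ ℕ.*-mono-≤ (ℕ.*-monoʳ-≤ (60 ^ h) (2*double≤4*4^ h)) (ℕ.^-monoˡ-≤ (double h) m≤n) ⟩
    60 ^ h ℕ.* (4 ℕ.* 4 ^ h) ℕ.* n ^ double h     ≡⟨ cong (ℕ._*_ (60 ^ h ℕ.* (4 ℕ.* 4 ^ h))) (^-double n h) ⟩
    60 ^ h ℕ.* (4 ℕ.* 4 ^ h) ℕ.* (n ℕ.* n) ^ h    ≡⟨ regroup (60 ^ h) (4 ^ h) ((n ℕ.* n) ^ h) ⟩
    4 ℕ.* (4 ^ h ℕ.* (60 ^ h ℕ.* (n ℕ.* n) ^ h))  ≡⟨ cong (4 ℕ.*_) q^h≡ ⟨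
    4 ℕ.* q ^ h                                   ≤⟨ ℕ.*-monoʳ-≤ 4 (^≤^*! q h) ⟩
    4 ℕ.* (q ^ q ℕ.* h !)                         ≤⟨ ℕ.*-monoʳ-≤ 4 (ℕ.*-monoʳ-≤ (q ^ q) (!≤double! h)) ⟩
    4 ℕ.* (q ^ q ℕ.* double h !)                  ≡⟨ rotate (q ^ q) (double h !) ⟩
    double h ! ℕ.* (4 ℕ.* q ^ q)                  ∎
    where
    q = coeffBase n
    q^h≡ : q ^ h ≡ 4 ^ h ℕ.* (60 ^ h ℕ.* (n ℕ.* n) ^ h)
    q^h≡ = trans (^-distribʳ-* 4 (60 ℕ.* (n ℕ.* n)) h) (cong (ℕ._*_ (4 ^ h)) (^-distribʳ-* 60 (n ℕ.* n) h))
    regroup : ∀ a b c → a ℕ.* (4 ℕ.* b) ℕ.* c ≡ 4 ℕ.* (b ℕ.* (a ℕ.* c))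
    regroup = solve-∀
    rotate : ∀ a b → 4 ℕ.* (a ℕ.* b) ≡ b ℕ.* (4 ℕ.* a)
    rotate = solve-∀

-- The summand of σ is local to its definition in Defs; `summandOf` recovers it by unification.
summandOf : ∀ {n} {F : ℕ → ℚ} (s : ℚ) → s ≡ sumTo n F → ℕ → ℚ
summandOf {F = F} _ _ = F

σ-summand : ℕ → ℕ → ℕ → ℚ
σ-summand r n = summandOf {n} (σ r n) refl

σ-summand≤ : ∀ r n i → i ℕ.< n → σ-summand r n i ≤ ℕtoℚ (n ^ r)
σ-summand≤ r n i i<n with suc i ∣? n
... | yes _ = ℕtoℚ-mono-≤ (ℕ.^-monoˡ-≤ r i<n)
... | no  _ = 0≤ℕtoℚ (n ^ r)

0≤σ-summand : ∀ r n i → 0ℚ ≤ σ-summand r n i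
0≤σ-summand r n i with suc i ∣? n
... | yes _ = 0≤ℕtoℚ (suc i ^ r)
... | no  _ = ≤-refl

σ≤ : ∀ r n → σ r n ≤ ℕtoℚ (n ℕ.* n ^ r)
σ≤ r n = begin
  sumTo n (σ-summand r n)      ≤⟨ sumTo-mono-≤ n (σ-summand≤ r n) ⟩
  sumTo n (λ _ → ℕtoℚ (n ^ r)) ≡⟨ sumTo-const n (ℕtoℚ (n ^ r)) ⟩
  ℕtoℚ n * ℕtoℚ (n ^ r)        ≡⟨ ℕtoℚ-* n (n ^ r) ⟨
  ℕtoℚ (n ℕ.* n ^ r)           ∎
  where open ≤-Reasoning

0≤σ : ∀ r n → 0ℚ ≤ σ r n
0≤σ r n = begin
  0ℚ                      ≡⟨ *-zeroʳ (ℕtoℚ n) ⟨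
  ℕtoℚ n * 0ℚ             ≡⟨ sumTo-const n 0ℚ ⟨
  sumTo n (λ _ → 0ℚ)      ≤⟨ sumTo-mono-≤ n (λ i _ → 0≤σ-summand r n i) ⟩
  sumTo n (σ-summand r n) ∎
  where open ≤-Reasoning

[2h]!*∣eisensteinConst∣≤ : ∀ p → ℕtoℚ (double (suc p) !) * ∣ eisensteinConst (double (suc p)) ∣ ≤ ℕtoℚ (60 ^ suc p ℕ.* (2 ℕ.* double (suc p)))
[2h]!*∣eisensteinConst∣≤ p = begin
  ℕtoℚ (k !) * ∣ eisensteinConst k ∣         ≡⟨ cong (ℕtoℚ (k !) *_) ∣C∣≡c*∣B⁻¹∣ ⟩
  ℕtoℚ (k !) * (c * ∣ inv B ∣)               ≤⟨ *-monoʳ-≤-nonNeg (c * ∣ inv B ∣) {{c∣B⁻¹∣-nonNeg}} (bernoulli-double-lowerBound p) ⟩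
  (E * ∣ B ∣) * (c * ∣ inv B ∣)              ≡⟨ solve 4 (λ e b c i → (e :* b) :* (c :* i) := (e :* c) :* (b :* i)) refl E (∣ B ∣) c (∣ inv B ∣) ⟩
  (E * c) * (∣ B ∣ * ∣ inv B ∣)              ≡⟨ cong ((E * c) *_) ∣B∣*∣B⁻¹∣≡1 ⟩
  (E * c) * 1ℚ                               ≡⟨ *-identityʳ (E * c) ⟩
  E * c                                      ≡⟨ ℕtoℚ-* (60 ^ suc p) (2 ℕ.* k) ⟨
  ℕtoℚ (60 ^ suc p ℕ.* (2 ℕ.* k))            ∎
  where
  open ≤-Reasoning
  k = double (suc p)
  B = bernoulli k
  c = ℕtoℚ (2 ℕ.* k)
  E = ℕtoℚ (60 ^ suc p)
  ∣C∣≡c*∣B⁻¹∣ : ∣ eisensteinConst k ∣ ≡ c * ∣ inv B ∣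
  ∣C∣≡c*∣B⁻¹∣ = trans (∣-p∣≡∣p∣ (c * inv B)) (trans (∣p*q∣≡∣p∣*∣q∣ c (inv B)) (cong (_* ∣ inv B ∣) (0≤p⇒∣p∣≡p (0≤ℕtoℚ (2 ℕ.* k)))))
  c∣B⁻¹∣-nonNeg : NonNegative (c * ∣ inv B ∣)
  c∣B⁻¹∣-nonNeg = nonNeg*nonNeg⇒nonNeg c {{nonNegative (0≤ℕtoℚ (2 ℕ.* k))}} ∣ inv B ∣ {{∣-∣-nonNeg (inv B)}}
  ∣B∣*∣B⁻¹∣≡1 : ∣ B ∣ * ∣ inv B ∣ ≡ 1ℚ
  ∣B∣*∣B⁻¹∣≡1 = trans (sym (∣p*q∣≡∣p∣*∣q∣ B (inv B))) (cong ∣_∣ (inv-inverseʳ B (bernoulli-double≢0 p)))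

∣eisensteinCoeff∣≤coeffBound : ∀ n p m → m ℕ.≤ n → ∣ eisensteinCoeff (double (suc p)) m ∣ ≤ ℕtoℚ (coeffBound n)
∣eisensteinCoeff∣≤coeffBound n p zero    _   = ℕtoℚ-mono-≤ (1≤coeffBound n)
∣eisensteinCoeff∣≤coeffBound n p (suc j) m≤n = *-cancelˡ-≤-pos (ℕtoℚ (k !)) {{positive (ℕtoℚ-mono-< {0} {k !} (ℕ.1≤n! k))}} (begin
  ℕtoℚ (k !) * ∣ Cₖ * S ∣                        ≡⟨ cong (ℕtoℚ (k !) *_) (trans (∣p*q∣≡∣p∣*∣q∣ Cₖ S) (cong (∣ Cₖ ∣ *_) (0≤p⇒∣p∣≡p (0≤σ (k ∸ 1) m)))) ⟩
  ℕtoℚ (k !) * (∣ Cₖ ∣ * S)                      ≡⟨ *-assoc (ℕtoℚ (k !)) ∣ Cₖ ∣ S ⟨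
  ℕtoℚ (k !) * ∣ Cₖ ∣ * S                        ≤⟨ *-monoʳ-≤-nonNeg S {{nonNegative (0≤σ (k ∸ 1) m)}} ([2h]!*∣eisensteinConst∣≤ p) ⟩
  ℕtoℚ (60 ^ suc p ℕ.* (2 ℕ.* k)) * S            ≤⟨ *-monoˡ-≤-nonNeg (ℕtoℚ (60 ^ suc p ℕ.* (2 ℕ.* k))) {{nonNegative (0≤ℕtoℚ (60 ^ suc p ℕ.* (2 ℕ.* k)))}} (σ≤ (k ∸ 1) m) ⟩
  ℕtoℚ (60 ^ suc p ℕ.* (2 ℕ.* k)) * ℕtoℚ (m ^ k) ≡⟨ ℕtoℚ-* (60 ^ suc p ℕ.* (2 ℕ.* k)) (m ^ k) ⟨
  ℕtoℚ (60 ^ suc p ℕ.* (2 ℕ.* k) ℕ.* m ^ k)      ≤⟨ ℕtoℚ-mono-≤ (60^h*2k*m^k≤k!*coeffBound n (suc p) m m≤n) ⟩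
  ℕtoℚ (k ! ℕ.* coeffBound n)                   ≡⟨ ℕtoℚ-* (k !) (coeffBound n) ⟩
  ℕtoℚ (k !) * ℕtoℚ (coeffBound n)              ∎)
  where
  open ≤-Reasoning
  k = double (suc p)
  m = suc j
  Cₖ = eisensteinConst k
  S = σ (k ∸ 1) m

IsEisensteinWeight⇒double : ∀ {k} → IsEisensteinWeight k → ∃[ p ] k ≡ double (suc p)
IsEisensteinWeight⇒double w with IsEisensteinWeight.even w | IsEisensteinWeight.four≤ w
... | divides zero    refl | ()
... | divides (suc p) refl | _  = p , *2≡double (suc p)
  where
  *2≡double : ∀ q → q ℕ.* 2 ≡ double q
  *2≡double zero    = refl
  *2≡double (suc q) = cong (suc ∘ suc) (*2≡double q)

∣eisensteinCoeff∣≤ : ∀ n {k} → IsEisensteinWeight k → ∀ m → m ℕ.≤ n → ∣ eisensteinCoeff k m ∣ ≤ ℕtoℚ (coeffBound n)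
∣eisensteinCoeff∣≤ n {k} w m m≤n = fromDouble (IsEisensteinWeight⇒double w)
  where
  fromDouble : ∃[ p ] k ≡ double (suc p) → ∣ eisensteinCoeff k m ∣ ≤ ℕtoℚ (coeffBound n)
  fromDouble (p , k≡) = subst (λ k → ∣ eisensteinCoeff k m ∣ ≤ ℕtoℚ (coeffBound n)) (sym k≡) (∣eisensteinCoeff∣≤coeffBound n p m m≤n)

∣⊛∣≤ : ∀ n {f g : Series} {a b} → (∀ i → i ℕ.≤ n → ∣ f i ∣ ≤ a) → (∀ i → i ℕ.≤ n → ∣ g i ∣ ≤ b) →
  ∀ j → j ℕ.≤ n → ∣ (f ⊛ g) j ∣ ≤ ℕtoℚ (suc n) * (a * b)
∣⊛∣≤ n {f} {g} {a} {b} ∣f∣≤a ∣g∣≤b j j≤n = begin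
  ∣ (f ⊛ g) j ∣                              ≤⟨ ∣sumTo∣≤sumTo∣∣ (suc j) (λ i → f i * g (j ∸ i)) ⟩
  sumTo (suc j) (λ i → ∣ f i * g (j ∸ i) ∣) ≤⟨ sumTo-mono-≤ (suc j) term≤ab ⟩
  sumTo (suc j) (λ _ → a * b)                ≡⟨ sumTo-const (suc j) (a * b) ⟩
  ℕtoℚ (suc j) * (a * b)                     ≤⟨ *-monoʳ-≤-nonNeg (a * b) {{ab-nonNeg}} (ℕtoℚ-mono-≤ (s≤s j≤n)) ⟩
  ℕtoℚ (suc n) * (a * b)                     ∎
  where
  open ≤-Reasoning
  a-nonNeg : NonNegative a
  a-nonNeg = nonNegative (≤-trans (0≤∣p∣ (f 0)) (∣f∣≤a 0 z≤n))
  ab-nonNeg : NonNegative (a * b)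
  ab-nonNeg = nonNeg*nonNeg⇒nonNeg a {{a-nonNeg}} b {{nonNegative (≤-trans (0≤∣p∣ (g 0)) (∣g∣≤b 0 z≤n))}}
  term≤ab : ∀ i → i ℕ.< suc j → ∣ f i * g (j ∸ i) ∣ ≤ a * b
  term≤ab i (s≤s i≤j) = begin
    ∣ f i * g (j ∸ i) ∣       ≡⟨ ∣p*q∣≡∣p∣*∣q∣ (f i) (g (j ∸ i)) ⟩
    ∣ f i ∣ * ∣ g (j ∸ i) ∣   ≤⟨ *-monoʳ-≤-nonNeg ∣ g (j ∸ i) ∣ {{∣-∣-nonNeg (g (j ∸ i))}} (∣f∣≤a i (ℕ.≤-trans i≤j j≤n)) ⟩
    a * ∣ g (j ∸ i) ∣         ≤⟨ *-monoˡ-≤-nonNeg a {{a-nonNeg}} (∣g∣≤b (j ∸ i) (ℕ.≤-trans (ℕ.m∸n≤m j i) j≤n)) ⟩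
    a * b                     ∎

productBound : ℕ → ℕ → ℕ
productBound n m = (suc n ℕ.* coeffBound n) ^ m

∣eisensteinProductCoeff∣≤ : ∀ n m (ks : Fin m → ℕ) → (∀ i → IsEisensteinWeight (ks i)) →
  ∀ j → j ℕ.≤ n → ∣ eisensteinProductCoeff m ks j ∣ ≤ ℕtoℚ (productBound n m)
∣eisensteinProductCoeff∣≤ n zero    ks ws zero    _   = ≤-refl
∣eisensteinProductCoeff∣≤ n zero    ks ws (suc j) _   = 0≤ℕtoℚ 1
∣eisensteinProductCoeff∣≤ n (suc m) ks ws j       j≤n = begin
  ∣ eisensteinProductCoeff (suc m) ks j ∣ ≤⟨ ∣⊛∣≤ n {f = eisensteinCoeff (ks Fin.zero)} {g = eisensteinProductCoeff m (ks ∘ Fin.suc)} (∣eisensteinCoeff∣≤ n (ws Fin.zero))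
                                                   (∣eisensteinProductCoeff∣≤ n m (ks ∘ Fin.suc) (ws ∘ Fin.suc)) j j≤n ⟩
  ℕtoℚ (suc n) * (K * P)                  ≡⟨ *-assoc (ℕtoℚ (suc n)) K P ⟨
  ℕtoℚ (suc n) * K * P                    ≡⟨ cong (_* P) (ℕtoℚ-* (suc n) (coeffBound n)) ⟨
  ℕtoℚ (suc n ℕ.* coeffBound n) * P       ≡⟨ ℕtoℚ-* (suc n ℕ.* coeffBound n) (productBound n m) ⟨
  ℕtoℚ (productBound n (suc m))           ∎
  where
  open ≤-Reasoning
  K = ℕtoℚ (coeffBound n)
  P = ℕtoℚ (productBound n m)

proposition3p6 : (n m : ℕ) → n > 0 → m > 0 →
    ∃[ B ] ((ks : Fin m → ℕ) → ((i : Fin m) → IsEisensteinWeight (ks i)) →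
      ∣ eisensteinProductCoeff m ks n ∣ ≤ B)
proposition3p6 n m _ _ = ℕtoℚ (productBound n m) , λ ks ws → ∣eisensteinProductCoeff∣≤ n m ks ws n ℕ.≤-refl
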